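{- Let $f=(f_0,f_1,f_2,\dots)\in\{1,-1\}^{\mathbb{N}}$ be any folding instruction sequence and let $n\ge 7$ be an integer. Put $N=\phi(n)$ and let $u=P_f[6N:6N+n-1]$. Then the first occurrence of $u$ in $P_f$ starts either at index $4N$ or at index $6N$. Moreover, $u$ occurs nowhere else in the prefix $P_f[1:6N+n-1]$: for every index $j$ with $1\le j\le 6N$, $j\neq 4N$, $j\ne 6N$, we have $P_f[j:j+n-1]\neq u$.
   Context: A folding instruction sequence is an infinite sequence $f=(f_0,f_1,f_2,\dots)$ with each $f_i\in\{1,-1\}$. The associated paper-folding sequence $P_f=P_f[1],P_f[2],\dots$ is defined as follows: for an integer $k\ge1$ write $k=2^s r$ with $r$ odd; then $P_f[k]=f_s$ if $r\equiv1\pmod 4$ and $P_f[k]=-f_s$ if $r\equiv 3\pmod 4$. For $i\le j$, $P_f[i:j]$ denotes the word $P_f[i]P_f[i+1]\cdots P_f[j]$. A word $w$ occurs (or appears) in $P_f$ starting at index $i$ if $P_f[i:i+|w|-1]=w$; its first occurrence is the least such $i$. For a positive integer $n$, $\phi(n)$ is the least power of $2$ that is $\ge n$, i.e. $\phi(n)=2^{\lceil\log_2 n\rceil}$. -}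

module Defs where

open import Data.Nat using (ℕ; zero; suc; _+_; _*_; _^_; _≤_; _<_)
open import Data.Nat.DivMod using (_%_; _/_)
open import Data.Nat.Logarithm using (⌈log₂_⌉)
open import Data.Sign using (Sign; opposite)
open import Data.List using (List; map; upTo; length)
open import Data.Product using (_×_)
open import Relation.Binary.PropositionalEquality using (_≡_; _≢_)

-- A folding instruction sequence: f i ∈ {1,-1}, encoded as Data.Sign (+ ↦ 1, - ↦ -1).
FoldInstr : Set
FoldInstr = ℕ → Sign

-- pf-go fuel f s k : with k = 2^t r (r odd), returns f (s+t) if r ≡ 1 mod 4
-- and -f (s+t) if r ≡ 3 mod 4.  Fuel k is enough since k is halved each step.
pf-go : ℕ → FoldInstr → ℕ → ℕ → Sign
pf-go zero f s k = f s
pf-go (suc fuel) f s k with k % 2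
... | suc _ with k % 4
...   | 1 = f s
...   | _ = opposite (f s)
pf-go (suc fuel) f s k | zero = pf-go fuel f (suc s) (k / 2)

-- Paper-folding sequence P_f[k] (meaningful for k ≥ 1).
P : FoldInstr → ℕ → Sign
P f k = pf-go k f 0 k

window : FoldInstr → ℕ → ℕ → List Sign
window f i m = map (λ t → P f (i + t)) (upTo m)

OccursAt : FoldInstr → List Sign → ℕ → Set
OccursAt f u i = 1 ≤ i × window f i (length u) ≡ u

FirstOccAt : FoldInstr → List Sign → ℕ → Set
FirstOccAt f u i = OccursAt f u i × (∀ j → 1 ≤ j → j < i → window f j (length u) ≢ u)

φ : ℕ → ℕ
φ n = 2 ^ ⌈log₂ n ⌉

{-# OPTIONS --safe #-}
module Submission where

-- If the length-n window at j matches the one at 6N, then j is even: on odd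
-- indices P_f[k + 2] = -P_f[k], so at odd j the entries at offsets 2 and 6
-- coincide, while at 6N, a multiple of 4, they are P_f'[3N + 1] and
-- P_f'[3N + 3] with f' = (f_1, f_2, ...), which differ.  Since
-- P_f[2k] = P_f'[k], the even-indexed halves of the two windows are then
-- matching windows of length about n/2 in P_f' at j/2 and 6(N/2).  This
-- halves N and n together; once n ≤ 12 only N ∈ {8, 16} remain, and these
-- are settled by checking all 2^7 prefixes (f_0, ..., f_6), which determine
-- P_f below index 128.

open import Defs
open import Data.Nat
open import Data.Nat.Properties
open import Data.Nat.DivMod
open import Data.Nat.Logarithm
open import Data.Nat.Tactic.RingSolver using (solve-∀)
open import Algebra.Properties.CommutativeSemigroup *-commutativeSemigroup using (x∙yz≈y∙xz)
open import Data.Sign using (Sign; opposite)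
import Data.Sign as Sign
open import Data.Sign.Properties using (opposite-involutive; s≢opposite[s]) renaming (_≟_ to _≟ₛ_)
open import Data.List using (upTo; applyUpTo; length)
open import Data.List.Properties using (map-applyUpTo; length-map; length-upTo; ∷-injectiveˡ; ∷-injectiveʳ; ≡-dec)
open import Data.Vec using (Vec; []; _∷_)
open import Data.Product using (∃-syntax; _×_; _,_)
open import Data.Sum using (_⊎_; inj₁; inj₂; [_,_]′) renaming (map to ⊎-map)
open import Data.Empty using (⊥-elim)
open import Function using (_∘_)
open import Relation.Nullary using (Dec; yes; no; ¬_)
open import Relation.Nullary.Decidable using (map′; _×-dec_; _→-dec_; ¬?; from-yes)
open import Relation.Binary.PropositionalEquality

shift : FoldInstr → FoldInstr
shift g s = g (suc s)

data EvenOdd : ℕ → Set where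
  even : ∀ q → EvenOdd (2 * q)
  odd  : ∀ q → EvenOdd (1 + 2 * q)

evenOdd : ∀ k → EvenOdd k
evenOdd zero = even 0
evenOdd (suc k) with evenOdd k
... | even q = odd q
... | odd q = subst EvenOdd (*-suc 2 q) (even (suc q))

2*q>0⇒q>0 : ∀ {q} → 0 < 2 * q → 0 < q
2*q>0⇒q>0 {suc q} _ = s≤s z≤n

2*q≤1+a⇒q≤a : ∀ {q a} → 0 < q → 2 * q ≤ suc a → q ≤ a
2*q≤1+a⇒q≤a {q} q>0 2q≤1+a = s≤s⁻¹ (<-≤-trans (m<m+n q (≤-trans q>0 (m≤m+n q 0))) 2q≤1+a)

pf-go-even : ∀ fuel g s q → pf-go (suc fuel) g s (2 * q) ≡ pf-go fuel g (suc s) q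
pf-go-even fuel g s q rewrite trans (cong (_% 2) (*-comm 2 q)) (m*n%n≡0 q 2) =
  cong (pf-go fuel g (suc s)) (trans (cong (_/ 2) (*-comm 2 q)) (m*n/n≡m q 2))

1+2q%2≡1 : ∀ q → (1 + 2 * q) % 2 ≡ 1
1+2q%2≡1 q = trans (cong (λ m → suc m % 2) (*-comm 2 q)) ([m+kn]%n≡m%n 1 q 2)

pf-go-odd-cong : ∀ a b g h s s′ q → g s ≡ h s′ →
                 pf-go (suc a) g s (1 + 2 * q) ≡ pf-go (suc b) h s′ (1 + 2 * q)
pf-go-odd-cong a b g h s s′ q gs≡hs′ rewrite 1+2q%2≡1 q with (1 + 2 * q) % 4
... | 1 = gs≡hs′
... | zero = cong opposite gs≡hs′
... | suc (suc _) = cong opposite gs≡hs′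

1+4r%4≡1 : ∀ r → (1 + 2 * (2 * r)) % 4 ≡ 1
1+4r%4≡1 r = trans (cong (_% 4) (index r)) ([m+kn]%n≡m%n 1 r 4)
  where
  index : ∀ r → 1 + 2 * (2 * r) ≡ 1 + r * 4
  index = solve-∀

3+4r%4≡3 : ∀ r → (1 + 2 * (1 + 2 * r)) % 4 ≡ 3
3+4r%4≡3 r = trans (cong (_% 4) (index r)) ([m+kn]%n≡m%n 3 r 4)
  where
  index : ∀ r → 1 + 2 * (1 + 2 * r) ≡ 3 + r * 4
  index = solve-∀

pf-go-1mod4 : ∀ fuel g s r → pf-go (suc fuel) g s (1 + 2 * (2 * r)) ≡ g s
pf-go-1mod4 fuel g s r rewrite 1+2q%2≡1 (2 * r) | 1+4r%4≡1 r = refl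

pf-go-3mod4 : ∀ fuel g s r → pf-go (suc fuel) g s (1 + 2 * (1 + 2 * r)) ≡ opposite (g s)
pf-go-3mod4 fuel g s r rewrite 1+2q%2≡1 (1 + 2 * r) | 3+4r%4≡3 r = refl

pf-go-shift : ∀ fuel g s k → pf-go fuel g (suc s) k ≡ pf-go fuel (shift g) s k
pf-go-shift zero g s k = refl
pf-go-shift (suc fuel) g s k with evenOdd k
... | even q = begin
  pf-go (suc fuel) g (suc s) (2 * q)      ≡⟨ pf-go-even fuel g (suc s) q ⟩
  pf-go fuel g (2 + s) q                  ≡⟨ pf-go-shift fuel g (suc s) q ⟩
  pf-go fuel (shift g) (suc s) q          ≡⟨ pf-go-even fuel (shift g) s q ⟨
  pf-go (suc fuel) (shift g) s (2 * q)    ∎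
  where open ≡-Reasoning
... | odd q = pf-go-odd-cong fuel fuel g (shift g) (suc s) s q refl

pf-go-fuel : ∀ {a b} g s k → 0 < k → k ≤ a → k ≤ b → pf-go a g s k ≡ pf-go b g s k
pf-go-fuel {suc a} {suc b} g s k k>0 k≤1+a k≤1+b with evenOdd k
... | odd q = pf-go-odd-cong a b g g s s q refl
... | even q = begin
  pf-go (suc a) g s (2 * q)  ≡⟨ pf-go-even a g s q ⟩
  pf-go a g (suc s) q        ≡⟨ pf-go-fuel g (suc s) q q>0 (2*q≤1+a⇒q≤a q>0 k≤1+a) (2*q≤1+a⇒q≤a q>0 k≤1+b) ⟩
  pf-go b g (suc s) q        ≡⟨ pf-go-even b g s q ⟨
  pf-go (suc b) g s (2 * q)  ∎
  where
  open ≡-Reasoning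
  q>0 = 2*q>0⇒q>0 k>0
pf-go-fuel {zero} _ _ _ () z≤n _
pf-go-fuel {suc _} {zero} _ _ _ () _ z≤n

P-even : ∀ g k → 0 < k → P g (2 * k) ≡ P (shift g) k
P-even g (suc k) _ = begin
  P g (2 * suc k)                                 ≡⟨ pf-go-even fuel g 0 (suc k) ⟩
  pf-go fuel g 1 (suc k)                          ≡⟨ pf-go-shift fuel g 0 (suc k) ⟩
  pf-go fuel (shift g) 0 (suc k)                  ≡⟨ pf-go-fuel (shift g) 0 (suc k) (s≤s z≤n) 1+k≤fuel ≤-refl ⟩
  P (shift g) (suc k)                             ∎
  where
  open ≡-Reasoning
  -- 2 * suc k reduces to suc fuel
  fuel = k + suc (k + 0)
  1+k≤fuel : suc k ≤ fuel
  1+k≤fuel = subst (suc k ≤_) (sym (+-suc k (k + 0))) (s≤s (m≤m+n k (k + 0)))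

P-odd-flip : ∀ g a → P g (3 + 2 * a) ≡ opposite (P g (1 + 2 * a))
P-odd-flip g a with evenOdd a
... | even r = begin
  P g (3 + 2 * (2 * r))               ≡⟨ cong (P g) (index r) ⟩
  P g (1 + 2 * (1 + 2 * r))           ≡⟨ pf-go-3mod4 _ g 0 r ⟩
  opposite (g 0)                      ≡⟨ cong opposite (pf-go-1mod4 _ g 0 r) ⟨
  opposite (P g (1 + 2 * (2 * r)))    ∎
  where
  open ≡-Reasoning
  index : ∀ r → 3 + 2 * (2 * r) ≡ 1 + 2 * (1 + 2 * r)
  index = solve-∀
... | odd r = begin
  P g (3 + 2 * (1 + 2 * r))                ≡⟨ cong (P g) (index r) ⟩
  P g (1 + 2 * (2 * (1 + r)))              ≡⟨ pf-go-1mod4 _ g 0 (1 + r) ⟩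
  g 0                                      ≡⟨ opposite-involutive (g 0) ⟨
  opposite (opposite (g 0))                ≡⟨ cong opposite (pf-go-3mod4 _ g 0 r) ⟨
  opposite (P g (1 + 2 * (1 + 2 * r)))     ∎
  where
  open ≡-Reasoning
  index : ∀ r → 3 + 2 * (1 + 2 * r) ≡ 1 + 2 * (2 * (1 + r))
  index = solve-∀

P-odd-period : ∀ g a → P g (5 + 2 * a) ≡ P g (1 + 2 * a)
P-odd-period g a = begin
  P g (5 + 2 * a)                       ≡⟨ cong (P g) (index a) ⟩
  P g (3 + 2 * (1 + a))                 ≡⟨ P-odd-flip g (1 + a) ⟩
  opposite (P g (1 + 2 * (1 + a)))      ≡⟨ cong (opposite ∘ P g) (index′ a) ⟩
  opposite (P g (3 + 2 * a))            ≡⟨ cong opposite (P-odd-flip g a) ⟩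
  opposite (opposite (P g (1 + 2 * a))) ≡⟨ opposite-involutive _ ⟩
  P g (1 + 2 * a)                       ∎
  where
  open ≡-Reasoning
  index : ∀ a → 5 + 2 * a ≡ 3 + 2 * (1 + a)
  index = solve-∀
  index′ : ∀ a → 1 + 2 * (1 + a) ≡ 3 + 2 * a
  index′ = solve-∀

P-cong : ∀ m {g h} → (∀ {s} → s < m → g s ≡ h s) → ∀ {k} → 0 < k → k < 2 ^ m → P g k ≡ P h k
P-cong zero _ k>0 k<1 = ⊥-elim (≤⇒≯ k>0 k<1)
P-cong (suc m) {g} {h} g≗h {k} k>0 k<2^[1+m] with evenOdd k
... | odd q = pf-go-odd-cong _ _ g h 0 0 q (g≗h (s≤s z≤n))
... | even q = begin
  P g (2 * q)      ≡⟨ P-even g q q>0 ⟩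
  P (shift g) q    ≡⟨ P-cong m (g≗h ∘ s≤s) q>0 (*-cancelˡ-< 2 q (2 ^ m) k<2^[1+m]) ⟩
  P (shift h) q    ≡⟨ P-even h q q>0 ⟨
  P h (2 * q)      ∎
  where
  open ≡-Reasoning
  q>0 = 2*q>0⇒q>0 k>0

Agree : FoldInstr → ℕ → ℕ → ℕ → Set
Agree g L i j = ∀ {t} → t < L → P g (i + t) ≡ P g (j + t)

applyUpTo-pointwise : ∀ {A : Set} (f h : ℕ → A) L → applyUpTo f L ≡ applyUpTo h L →
                      ∀ {t} → t < L → f t ≡ h t
applyUpTo-pointwise f h (suc L) eq {zero} _ = ∷-injectiveˡ eq
applyUpTo-pointwise f h (suc L) eq {suc t} (s≤s t<L) =
  applyUpTo-pointwise (f ∘ suc) (h ∘ suc) L (∷-injectiveʳ eq) t<L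

window⇒Agree : ∀ {g i j L} → window g i L ≡ window g j L → Agree g L i j
window⇒Agree {g} {i} {j} {L} eq = applyUpTo-pointwise _ _ L (begin
  applyUpTo (λ t → P g (i + t)) L  ≡⟨ map-applyUpTo (λ t → t) _ L ⟨
  window g i L                     ≡⟨ eq ⟩
  window g j L                     ≡⟨ map-applyUpTo (λ t → t) _ L ⟩
  applyUpTo (λ t → P g (j + t)) L  ∎)
  where open ≡-Reasoning

Agree-shorten : ∀ {g L L′ i j} → L ≤ L′ → Agree g L′ i j → Agree g L i j
Agree-shorten L≤L′ agree t<L = agree (<-≤-trans t<L L≤L′)

Agree-halve : ∀ {g L L′ i j} → 0 < i → 0 < j → 2 * L′ ≤ suc L →
              Agree g L (2 * i) (2 * j) → Agree (shift g) L′ i j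
Agree-halve {g} {L} {L′} {i} {j} i>0 j>0 2L′≤1+L agree {t} t<L′ = begin
  P (shift g) (i + t)   ≡⟨ P-even g (i + t) (≤-trans i>0 (m≤m+n i t)) ⟨
  P g (2 * (i + t))     ≡⟨ cong (P g) (*-distribˡ-+ 2 i t) ⟩
  P g (2 * i + 2 * t)   ≡⟨ agree 2t<L ⟩
  P g (2 * j + 2 * t)   ≡⟨ cong (P g) (*-distribˡ-+ 2 j t) ⟨
  P g (2 * (j + t))     ≡⟨ P-even g (j + t) (≤-trans j>0 (m≤m+n j t)) ⟩
  P (shift g) (j + t)   ∎
  where
  open ≡-Reasoning
  2t<L : 2 * t < L
  2t<L = s≤s⁻¹ (≤-trans (≤-reflexive (sym (*-suc 2 t))) (≤-trans (*-monoʳ-≤ 2 t<L′) 2L′≤1+L))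

half-length : ∀ L → ∃[ L′ ] L ≤ 2 * L′ × 2 * L′ ≤ suc L
half-length L with evenOdd L
... | even q = q , ≤-refl , n≤1+n (2 * q)
... | odd q = suc q , ≤-trans (n≤1+n (suc (2 * q))) (≤-reflexive (sym (*-suc 2 q))) , ≤-reflexive (*-suc 2 q)

odd-mismatch : ∀ g a c {L} → 7 ≤ L → ¬ Agree g L (1 + 2 * a) (4 * c)
odd-mismatch g a c 7≤L agree = s≢opposite[s] x (begin
  x                                 ≡⟨ P-even g (1 + 2 * c) (s≤s z≤n) ⟨
  P g (2 * (1 + 2 * c))             ≡⟨ cong (P g) (index₂ c) ⟩
  P g (4 * c + 2)                   ≡⟨ agree (≤-trans (s≤s (s≤s (s≤s z≤n))) 7≤L) ⟨
  P g (1 + 2 * a + 2)               ≡⟨ cong (P g) (index₂′ a) ⟩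
  P g (1 + 2 * (1 + a))             ≡⟨ P-odd-period g (1 + a) ⟨
  P g (5 + 2 * (1 + a))             ≡⟨ cong (P g) (index₆′ a) ⟩
  P g (1 + 2 * a + 6)               ≡⟨ agree 7≤L ⟩
  P g (4 * c + 6)                   ≡⟨ cong (P g) (index₆ c) ⟩
  P g (2 * (3 + 2 * c))             ≡⟨ P-even g (3 + 2 * c) (s≤s z≤n) ⟩
  P (shift g) (3 + 2 * c)           ≡⟨ P-odd-flip (shift g) c ⟩
  opposite x                        ∎)
  where
  open ≡-Reasoning
  x = P (shift g) (1 + 2 * c)
  index₂ : ∀ c → 2 * (1 + 2 * c) ≡ 4 * c + 2
  index₂ = solve-∀
  index₆ : ∀ c → 4 * c + 6 ≡ 2 * (3 + 2 * c)
  index₆ = solve-∀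
  index₂′ : ∀ a → 1 + 2 * a + 2 ≡ 1 + 2 * (1 + a)
  index₂′ = solve-∀
  index₆′ : ∀ a → 5 + 2 * (1 + a) ≡ 1 + 2 * a + 6
  index₆′ = solve-∀

Agree-prefix : ∀ m {g h L i j} → (∀ {s} → s < m → g s ≡ h s) → 0 < i → 0 < j →
               i + L ≤ 2 ^ m → j + L ≤ 2 ^ m → Agree g L i j → Agree h L i j
Agree-prefix m {g} {h} {L} {i} {j} g≗h i>0 j>0 i+L≤2^m j+L≤2^m agree {t} t<L = begin
  P h (i + t)  ≡⟨ P-cong m (sym ∘ g≗h) (≤-trans i>0 (m≤m+n i t)) (inside i+L≤2^m) ⟩
  P g (i + t)  ≡⟨ agree t<L ⟩
  P g (j + t)  ≡⟨ P-cong m g≗h (≤-trans j>0 (m≤m+n j t)) (inside j+L≤2^m) ⟩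
  P h (j + t)  ∎
  where
  open ≡-Reasoning
  inside : ∀ {x} → x + L ≤ 2 ^ m → x + t < 2 ^ m
  inside {x} x+L≤2^m = <-≤-trans (+-monoʳ-< x t<L) x+L≤2^m

agree? : ∀ g L i j → Dec (Agree g L i j)
agree? g L i j = allUpTo? (λ t → P g (i + t) ≟ₛ P g (j + t)) L

NoOtherMatch : FoldInstr → ℕ → ℕ → ℕ → Set
NoOtherMatch g L A T = ∀ {j} → j < suc T → 0 < j → j ≢ A → j ≢ T → ¬ Agree g L j T

noOtherMatch? : ∀ g L A T → Dec (NoOtherMatch g L A T)
noOtherMatch? g L A T = allUpTo?
  (λ j → (0 <? j) →-dec (¬? (j ≟ A) →-dec (¬? (j ≟ T) →-dec ¬? (agree? g L j T))))
  (suc T)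

fromVec : ∀ {m} → Vec Sign m → FoldInstr
fromVec [] _ = Sign.+
fromVec (x ∷ v) zero = x
fromVec (x ∷ v) (suc s) = fromVec v s

restrict : FoldInstr → (m : ℕ) → Vec Sign m
restrict g zero = []
restrict g (suc m) = g 0 ∷ restrict (shift g) m

fromVec-restrict : ∀ g {m s} → s < m → g s ≡ fromVec (restrict g m) s
fromVec-restrict g {suc m} {zero} _ = refl
fromVec-restrict g {suc m} {suc s} (s≤s s<m) = fromVec-restrict (shift g) s<m

all-Vec? : ∀ m {P : Vec Sign m → Set} → (∀ v → Dec (P v)) → Dec (∀ v → P v)
all-Vec? zero P? = map′ (λ p → λ { [] → p }) (λ p → p []) (P? [])
all-Vec? (suc m) P? = map′
  (λ { (p₊ , p₋) → λ { (Sign.+ ∷ v) → p₊ v ; (Sign.- ∷ v) → p₋ v } })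
  (λ p → (λ v → p (Sign.+ ∷ v)) , (λ v → p (Sign.- ∷ v)))
  (all-Vec? m (λ v → P? (Sign.+ ∷ v)) ×-dec all-Vec? m (λ v → P? (Sign.- ∷ v)))

matches-by-search : ∀ m {L A T} → T + L ≤ 2 ^ m → (∀ v → NoOtherMatch (fromVec {m} v) L A T) →
                    ∀ g {L′ j} → L ≤ L′ → 0 < j → j ≤ T → Agree g L′ j T → j ≡ A ⊎ j ≡ T
matches-by-search m {L} {A} {T} T+L≤2^m none g {j = j} L≤L′ j>0 j≤T agree with j ≟ A | j ≟ T
... | yes j≡A | _ = inj₁ j≡A
... | no _ | yes j≡T = inj₂ j≡T
... | no j≢A | no j≢T = ⊥-elim (none (restrict g m) (s≤s j≤T) j>0 j≢A j≢T
        (Agree-prefix m (fromVec-restrict g) j>0 (≤-trans j>0 j≤T)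
           (≤-trans (+-monoˡ-≤ L j≤T) T+L≤2^m) T+L≤2^m (Agree-shorten {g} {i = j} {T} L≤L′ agree)))

no-other-match-8 : ∀ v → NoOtherMatch (fromVec {7} v) 7 32 48
no-other-match-8 = from-yes (all-Vec? 7 (λ v → noOtherMatch? (fromVec v) 7 32 48))

no-other-match-16 : ∀ v → NoOtherMatch (fromVec {7} v) 9 64 96
no-other-match-16 = from-yes (all-Vec? 7 (λ v → noOtherMatch? (fromVec v) 9 64 96))

halving-step : ∀ N {g L j} → 0 < N →
               (∀ {L′ j′} → 7 ≤ L′ → N < 2 * L′ → 0 < j′ → j′ ≤ 6 * N →
                  Agree (shift g) L′ j′ (6 * N) → j′ ≡ 4 * N ⊎ j′ ≡ 6 * N) →
               13 ≤ L → 2 * N < 2 * L → 0 < j → j ≤ 6 * (2 * N) → Agree g L j (6 * (2 * N)) →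
               j ≡ 4 * (2 * N) ⊎ j ≡ 6 * (2 * N)
halving-step N {g} {L} {j} N>0 recurse 13≤L 2N<2L j>0 j≤12N agree with evenOdd j
... | odd a = ⊥-elim (odd-mismatch g a (3 * N) (≤-trans (m≤n+m 7 6) 13≤L)
                        (subst (Agree g L j) (trans (sym (*-assoc 6 2 N)) (*-assoc 4 3 N)) agree))
... | even j′ with half-length L
...   | L′ , L≤2L′ , 2L′≤1+L =
  ⊎-map (double (x∙yz≈y∙xz 2 4 N)) (double (x∙yz≈y∙xz 2 6 N))
    (recurse (*-cancelˡ-< 2 6 L′ (<-≤-trans 13≤L L≤2L′))
             (≤-trans (*-cancelˡ-< 2 N L 2N<2L) L≤2L′) j′>0
             (*-cancelˡ-≤ 2 (≤-trans j≤12N (≤-reflexive (x∙yz≈y∙xz 6 2 N))))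
             (Agree-halve {g} {L} {L′} {j′} {6 * N} j′>0 (≤-trans N>0 (m≤n*m N 6)) 2L′≤1+L
                (subst (Agree g L (2 * j′)) (x∙yz≈y∙xz 6 2 N) agree)))
  where
  j′>0 = 2*q>0⇒q>0 j>0
  double : ∀ {x y z} → 2 * y ≡ z → x ≡ y → 2 * x ≡ z
  double 2y≡z refl = 2y≡z

matches-at-6N : ∀ k g {L j} → 7 ≤ L → 2 ^ (3 + k) < 2 * L → 0 < j → j ≤ 6 * 2 ^ (3 + k) →
                Agree g L j (6 * 2 ^ (3 + k)) → j ≡ 4 * 2 ^ (3 + k) ⊎ j ≡ 6 * 2 ^ (3 + k)
matches-at-6N zero g 7≤L _ = matches-by-search 7 (from-yes (48 + 7 ≤? 2 ^ 7)) no-other-match-8 g 7≤L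
matches-at-6N (suc k) g {L} 7≤L N<2L with 13 ≤? L
... | yes 13≤L = halving-step (2 ^ (3 + k)) (m^n>0 2 (3 + k)) (matches-at-6N k (shift g)) 13≤L N<2L
matches-at-6N (suc zero) g 7≤L N<2L | no _ =
  matches-by-search 7 (from-yes (96 + 9 ≤? 2 ^ 7)) no-other-match-16 g (*-cancelˡ-< 2 8 _ N<2L)
matches-at-6N (suc (suc k)) g {L} 7≤L N<2L | no L≱13 =
  ⊥-elim (L≱13 (≤-trans (m≤m+n 13 3) (<⇒≤ (≤-<-trans (^-monoʳ-≤ 2 (m≤m+n 4 k)) (*-cancelˡ-< 2 (2 ^ (4 + k)) L N<2L)))))

pow2-between : ∀ n → ∃[ m ] suc n ≤ 2 ^ m × 2 ^ m < 2 * suc n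
pow2-between zero = 0 , ≤-refl , s≤s (s≤s z≤n)
pow2-between (suc n) with pow2-between n
... | m , 1+n≤2^m , 2^m<2+2n with 2 + n ≤? 2 ^ m
...   | yes 2+n≤2^m = m , 2+n≤2^m , <-≤-trans 2^m<2+2n (*-monoʳ-≤ 2 (n≤1+n (suc n)))
...   | no 2+n≰2^m = suc m , 2+n≤2^[1+m] , *-monoʳ-< 2 (≤-reflexive (cong suc 2^m≡1+n))
  where
  2^m≡1+n : 2 ^ m ≡ suc n
  2^m≡1+n = ≤-antisym (s≤s⁻¹ (≰⇒> 2+n≰2^m)) 1+n≤2^m
  2+n≤2^[1+m] : 2 + n ≤ 2 * 2 ^ m
  2+n≤2^[1+m] = subst (2 + n ≤_) (cong (2 *_) (sym 2^m≡1+n))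
                  (subst (2 + n ≤_) (sym (*-suc 2 n)) (+-monoʳ-≤ 2 (m≤n*m n 2)))

⌈2*n/2⌉≡n : ∀ n → ⌈ 2 * n /2⌉ ≡ n
⌈2*n/2⌉≡n n = sym (trans (n≡⌈n+n/2⌉ n) (cong (λ m → ⌈ n + m /2⌉) (sym (+-identityʳ n))))

n≤2*⌈n/2⌉ : ∀ n → n ≤ 2 * ⌈ n /2⌉
n≤2*⌈n/2⌉ n = begin
  n                          ≡⟨ ⌊n/2⌋+⌈n/2⌉≡n n ⟨
  ⌊ n /2⌋ + ⌈ n /2⌉          ≤⟨ +-monoˡ-≤ ⌈ n /2⌉ (⌊n/2⌋≤⌈n/2⌉ n) ⟩
  ⌈ n /2⌉ + ⌈ n /2⌉          ≡⟨ cong (⌈ n /2⌉ +_) (+-identityʳ ⌈ n /2⌉) ⟨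
  2 * ⌈ n /2⌉                ∎
  where open ≤-Reasoning

⌈log₂⌉-unique : ∀ m {n} → n ≤ 2 ^ m → 2 ^ m < 2 * n → ⌈log₂ n ⌉ ≡ m
⌈log₂⌉-unique zero {1} _ _ = refl
⌈log₂⌉-unique zero {suc (suc _)} (s≤s ()) _
⌈log₂⌉-unique (suc m) {n} n≤2^[1+m] 2^[1+m]<2n = begin
  ⌈log₂ n ⌉                  ≡⟨ m∸n+n≡m log≥1 ⟨
  ⌈log₂ n ⌉ ∸ 1 + 1          ≡⟨ cong (_+ 1) (⌈log₂⌈n/2⌉⌉≡⌈log₂n⌉∸1 n) ⟨
  ⌈log₂ ⌈ n /2⌉ ⌉ + 1        ≡⟨ cong (_+ 1) (⌈log₂⌉-unique m ⌈n/2⌉≤2^m 2^m<2⌈n/2⌉) ⟩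
  m + 1                      ≡⟨ +-comm m 1 ⟩
  suc m                      ∎
  where
  open ≡-Reasoning
  2^m<n : 2 ^ m < n
  2^m<n = *-cancelˡ-< 2 (2 ^ m) n 2^[1+m]<2n
  ⌈n/2⌉≤2^m : ⌈ n /2⌉ ≤ 2 ^ m
  ⌈n/2⌉≤2^m = ≤-trans (⌈n/2⌉-mono n≤2^[1+m]) (≤-reflexive (⌈2*n/2⌉≡n (2 ^ m)))
  2^m<2⌈n/2⌉ : 2 ^ m < 2 * ⌈ n /2⌉
  2^m<2⌈n/2⌉ = <-≤-trans 2^m<n (n≤2*⌈n/2⌉ n)
  log≥1 : 1 ≤ ⌈log₂ n ⌉
  log≥1 = subst (_≤ ⌈log₂ n ⌉) (⌈log₂2^n⌉≡n 1) (⌈log₂⌉-mono-≤ (≤-trans (s≤s (m^n>0 2 m)) 2^m<n))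

φ-bounds : ∀ {n} → 0 < n → n ≤ φ n × φ n < 2 * n
φ-bounds {suc n} _ with pow2-between n
... | m , 1+n≤2^m , 2^m<2+2n =
  subst (λ c → suc n ≤ 2 ^ c × 2 ^ c < 2 * suc n) (sym (⌈log₂⌉-unique m 1+n≤2^m 2^m<2+2n))
        (1+n≤2^m , 2^m<2+2n)

φ-exponent : ∀ {n} → 7 ≤ n → ∃[ k ] φ n ≡ 2 ^ (3 + k) × 2 ^ (3 + k) < 2 * n
φ-exponent {n} 7≤n with φ-bounds (≤-trans (s≤s z≤n) 7≤n)
... | n≤φn , φn<2n with exponent≥3 ⌈log₂ n ⌉ (≤-trans 7≤n n≤φn)
  where
  exponent≥3 : ∀ c → 7 ≤ 2 ^ c → ∃[ k ] 2 ^ c ≡ 2 ^ (3 + k)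
  exponent≥3 (suc (suc (suc k))) _ = k , refl
  exponent≥3 0 (s≤s ())
  exponent≥3 1 (s≤s (s≤s ()))
  exponent≥3 2 (s≤s (s≤s (s≤s (s≤s ()))))
... | k , φn≡N = k , φn≡N , subst (_< 2 * n) φn≡N φn<2n

first-occurrence : ∀ f u {A T} → 0 < A → A ≤ T → window f T (length u) ≡ u →
                   (∀ j → 0 < j → j ≤ T → j ≢ A → j ≢ T → window f j (length u) ≢ u) →
                   FirstOccAt f u A ⊎ FirstOccAt f u T
first-occurrence f u {A} {T} A>0 A≤T at-T unique with ≡-dec _≟ₛ_ (window f A (length u)) u
... | yes at-A = inj₁ ((A>0 , at-A) , λ j j>0 j<A →
        unique j j>0 (≤-trans (<⇒≤ j<A) A≤T) (<⇒≢ j<A) (<⇒≢ (<-≤-trans j<A A≤T)))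
... | no not-at-A = inj₂ ((≤-trans A>0 A≤T , at-T) , λ j j>0 j<T at-j →
        unique j j>0 (<⇒≤ j<T) (λ { refl → not-at-A at-j }) (<⇒≢ j<T) at-j)

length-window : ∀ f i n → length (window f i n) ≡ n
length-window f i n = trans (length-map _ (upTo n)) (length-upTo n)

no-other-occurrence : ∀ f k {n} → 7 ≤ n → 2 ^ (3 + k) < 2 * n →
                      ∀ j → 0 < j → j ≤ 6 * 2 ^ (3 + k) → j ≢ 4 * 2 ^ (3 + k) → j ≢ 6 * 2 ^ (3 + k) →
                      window f j n ≢ window f (6 * 2 ^ (3 + k)) n
no-other-occurrence f k {n} 7≤n N<2n j j>0 j≤6N j≢4N j≢6N same =
  [ j≢4N , j≢6N ]′ (matches-at-6N k f 7≤n N<2n j>0 j≤6N (window⇒Agree {f} {j} {6 * 2 ^ (3 + k)} {n} same))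

lemma3p1 : (f : FoldInstr) (n : ℕ) → 7 ≤ n →
    (FirstOccAt f (window f (6 * φ n) n) (4 * φ n) ⊎ FirstOccAt f (window f (6 * φ n) n) (6 * φ n))
    × (∀ j → 1 ≤ j → j ≤ 6 * φ n → j ≢ 4 * φ n → j ≢ 6 * φ n → window f j n ≢ window f (6 * φ n) n)
lemma3p1 f n 7≤n with φ-exponent 7≤n
... | k , φn≡N , N<2n rewrite φn≡N =
  first-occurrence f (window f (6 * N) n) 4N>0 4N≤6N (resize (6 * N)) (λ j j>0 j≤6N j≢4N j≢6N →
    no-other j j>0 j≤6N j≢4N j≢6N ∘ trans (sym (resize j))) , no-other
  where
  N = 2 ^ (3 + k)
  4N>0 = ≤-trans (m^n>0 2 (3 + k)) (m≤n*m N 4)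
  4N≤6N = *-monoˡ-≤ N (m≤m+n 4 2)
  resize : ∀ i → window f i (length (window f (6 * N) n)) ≡ window f i n
  resize i = cong (window f i) (length-window f (6 * N) n)
  no-other = no-other-occurrence f k 7≤n N<2n
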